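{- For every odd integer $j\ge1$ and all even integers $a_{j+2}\ge a_{j+1}\ge2$, the tree $RT(0^j,a_{j+1},a_{j+2})$ is super edge-graceful.
   Context: For a finite simple graph $G$ with $p$ vertices and $q$ edges, $G$ is super edge-graceful if there is a bijection $f$ from $E(G)$ onto $\{0,\pm1,\ldots,\pm\frac{q-1}{2}\}$ when $q$ is odd, and onto $\{\pm1,\ldots,\pm\frac{q}{2}\}$ when $q$ is even, such that the induced vertex labeling $f^+(v)=\sum_{uv\in E(G)} f(uv)$ is a bijection from $V(G)$ onto $\{0,\pm1,\ldots,\pm\frac{p-1}{2}\}$ when $p$ is odd, and onto $\{\pm1,\ldots,\pm\frac{p}{2}\}$ when $p$ is even. $RT(0^j,a,b)$ denotes the rooted tree with root $v_0$ having $j+2$ children: $j$ of them are leaves, one has exactly $a$ children (all leaves) and one has exactly $b$ children (all leaves). -}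

module Defs where

open import Data.Nat as ℕ using (ℕ; zero; suc; _≤_; _<_; _≤ᵇ_; _/_)
open import Data.Integer as ℤ using (ℤ; ∣_∣)
open import Data.Fin using (Fin; zero; suc; toℕ)
open import Data.Fin.Properties using (_≟_)
open import Data.List using (List; foldr; map; allFin)
open import Data.Bool using (Bool; if_then_else_; _∨_)
open import Data.Product using (_×_; _,_; proj₁; proj₂; Σ; ∃)
open import Relation.Nullary using (¬_)
open import Relation.Nullary.Decidable using (⌊_⌋)
open import Relation.Binary.PropositionalEquality using (_≡_; _≢_)
open import Function.Definitions using (Injective)

Even : ℕ → Set
Even n = ∃ λ k → n ≡ k ℕ.+ k

Odd : ℕ → Set
Odd n = ∃ λ k → n ≡ suc (k ℕ.+ k)

record Graph : Set where
  field
    p    : ℕ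
    q    : ℕ
    ends : Fin q → Fin p × Fin p
open Graph public

-- The label set of size n:
--   n odd  : {0, ±1, …, ±(n-1)/2}
--   n even : {±1, …, ±n/2}
-- i.e. |z| ≤ ⌊n/2⌋, and z ≠ 0 when n is even.
InLabels : ℕ → ℤ → Set
InLabels n z = (∣ z ∣ ≤ n / 2) × (Even n → z ≢ ℤ.0ℤ)

BijOntoLabels : (m n : ℕ) → (Fin m → ℤ) → Set
BijOntoLabels m n g =
  Injective _≡_ _≡_ g
  × (∀ i → InLabels n (g i))
  × (∀ z → InLabels n z → ∃ λ i → g i ≡ z)

incident : (G : Graph) → Fin (q G) → Fin (p G) → Bool
incident G e v = ⌊ proj₁ (ends G e) ≟ v ⌋ ∨ ⌊ proj₂ (ends G e) ≟ v ⌋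

vertexSum : (G : Graph) → (Fin (q G) → ℤ) → Fin (p G) → ℤ
vertexSum G f v =
  foldr ℤ._+_ ℤ.0ℤ (map (λ e → if incident G e v then f e else ℤ.0ℤ) (allFin (q G)))

SuperEdgeGraceful : Graph → Set
SuperEdgeGraceful G =
  Σ (Fin (q G) → ℤ) λ f →
    BijOntoLabels (q G) (q G) f × BijOntoLabels (p G) (p G) (vertexSum G f)

-- Vertices: Fin (3 + j + a + b), numbered as
--   0                      : the root v₀
--   1                      : the child of v₀ having a leaf children
--   2                      : the child of v₀ having b leaf children
--   3 … 2+j                : the j leaf children of v₀
--   3+j … 2+j+a            : the a leaf children of vertex 1
--   3+j+a … 2+j+a+b        : the b leaf children of vertex 2
-- Edges: Fin (2 + j + a + b); edge e joins vertex e+1 to its parent.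
RT-parent : (j a b : ℕ) → ℕ → Fin (3 ℕ.+ j ℕ.+ a ℕ.+ b)
RT-parent j a b k =
  if k ≤ᵇ (2 ℕ.+ j) then zero
  else if k ≤ᵇ (2 ℕ.+ j ℕ.+ a) then suc zero
  else suc (suc zero)

RT : (j a b : ℕ) → Graph
RT j a b = record
  { p    = 3 ℕ.+ j ℕ.+ a ℕ.+ b
  ; q    = 2 ℕ.+ j ℕ.+ a ℕ.+ b
  ; ends = λ e → RT-parent j a b (suc (toℕ e)) , suc e
  }

-- Write j = 2s+1, a = 2m, b = 2n+2 and N = s+m+n+2, so the tree has q = 2N+1 edges
-- and p = 2N+2 vertices.  Let φ enumerate ℤ as 0, 1, -1, 2, -2, …; its first 2N+1
-- values are exactly the edge labels.  Edge i (joining vertex i+1 to its parent) gets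
-- φ(i), corrected by the transpositions 0 ↔ 1 and -1 ↔ N: the edge labels are then
--   1, 0, N, 2, -2, 3, -3, …, N-1, -(N-1), -1, -N.
-- Consecutive pairs t, -t cancel, so the root sums to 1 + 0 + N = N+1, vertex 1 to 1,
-- vertex 2 to 0 - 1 - N = -(N+1), and each leaf i+1 ≥ 3 to its own edge label; these
-- vertex labels form {±1, …, ±(N+1)}.

module Submission where

open import Defs
open import Data.Nat as ℕ using (ℕ; zero; suc; _≤_; _<_; z≤n; s≤s; _/_; _≤ᵇ_)
import Data.Nat.Properties as ℕₚ
open import Data.Nat.DivMod using (m/n≡1+[m∸n]/n; /-monoˡ-≤)
open import Data.Integer as ℤ using (ℤ; +_; -[1+_]; ∣_∣; 0ℤ)
import Data.Integer.Properties as ℤₚ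
open import Data.Fin using (Fin; zero; suc; toℕ; fromℕ<)
open import Data.Fin.Properties as Finₚ using (toℕ-injective; toℕ-fromℕ<; toℕ<n)
open import Data.List using (foldr; tabulate)
open import Data.List.Properties using (map-tabulate)
open import Data.Bool using (true; false; if_then_else_; _∨_; T)
open import Data.Bool.Properties using (∨-zeroʳ)
open import Data.Product using (_×_; _,_; ∃)
open import Data.Sum using (_⊎_; inj₁; inj₂)
open import Data.Empty using (⊥; ⊥-elim)
open import Relation.Nullary using (¬_; yes; no; does)
open import Relation.Nullary.Decidable using (⌊_⌋; dec-true; dec-false)
open import Data.Integer.Tactic.RingSolver using (solve-∀)
import Data.Nat.Tactic.RingSolver as ℕ-Solver
open import Relation.Binary.PropositionalEquality

halve-+2 : ∀ n → suc (suc n) / 2 ≡ suc (n / 2)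
halve-+2 n = m/n≡1+[m∸n]/n {suc (suc n)} {2} (s≤s (s≤s z≤n))

halve-double : ∀ N → (N ℕ.+ N) / 2 ≡ N
halve-double zero    = refl
halve-double (suc N) = begin
  suc (N ℕ.+ suc N) / 2    ≡⟨ cong (λ k → suc k / 2) (ℕₚ.+-suc N N) ⟩
  suc (suc (N ℕ.+ N)) / 2  ≡⟨ halve-+2 (N ℕ.+ N) ⟩
  suc ((N ℕ.+ N) / 2)      ≡⟨ cong suc (halve-double N) ⟩
  suc N                    ∎
  where open ≡-Reasoning

halve-double+1 : ∀ N → suc (N ℕ.+ N) / 2 ≡ N
halve-double+1 zero    = refl
halve-double+1 (suc N) = begin
  suc (suc (N ℕ.+ suc N)) / 2    ≡⟨ cong (λ k → suc (suc k) / 2) (ℕₚ.+-suc N N) ⟩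
  suc (suc (suc (N ℕ.+ N))) / 2  ≡⟨ halve-+2 (suc (N ℕ.+ N)) ⟩
  suc (suc (N ℕ.+ N) / 2)        ≡⟨ cong suc (halve-double+1 N) ⟩
  suc N                          ∎
  where open ≡-Reasoning

halve-double+2 : ∀ N → suc (suc (N ℕ.+ N)) / 2 ≡ suc N
halve-double+2 N = trans (halve-+2 (N ℕ.+ N)) (cong suc (halve-double N))

odd-not-even : ∀ N → ¬ Even (suc (N ℕ.+ N))
odd-not-even N (k , 1+2N≡2k) = ℕₚ.1+n≢n (trans 1+2N≡2k (cong₂ ℕ._+_ k≡N k≡N))
  where
  k≡N : k ≡ N
  k≡N = trans (sym (halve-double k)) (trans (cong (_/ 2) (sym 1+2N≡2k)) (halve-double+1 N))

double-≤ : ∀ {a N} → a ℕ.+ a ≤ suc (N ℕ.+ N) → a ≤ N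
double-≤ {a} {N} 2a≤2N+1 = subst₂ _≤_ (halve-double a) (halve-double+1 N) (/-monoˡ-≤ 2 2a≤2N+1)

module _ {N : ℕ} {z : ℤ} where

  odd-labels⁺ : ∣ z ∣ ≤ N → InLabels (suc (N ℕ.+ N)) z
  odd-labels⁺ |z|≤N = subst (∣ z ∣ ≤_) (sym (halve-double+1 N)) |z|≤N , λ ev → ⊥-elim (odd-not-even N ev)

  odd-labels⁻ : InLabels (suc (N ℕ.+ N)) z → ∣ z ∣ ≤ N
  odd-labels⁻ (|z|≤ , _) = subst (∣ z ∣ ≤_) (halve-double+1 N) |z|≤

  even-labels⁺ : ∣ z ∣ ≤ suc N → z ≢ 0ℤ → InLabels (suc (suc (N ℕ.+ N))) z
  even-labels⁺ |z|≤ z≢0 = subst (∣ z ∣ ≤_) (sym (halve-double+2 N)) |z|≤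
                        , λ _ → z≢0

  even-labels⁻ : InLabels (suc (suc (N ℕ.+ N))) z → ∣ z ∣ ≤ suc N × z ≢ 0ℤ
  even-labels⁻ (|z|≤ , z≢0) = subst (∣ z ∣ ≤_) (halve-double+2 N) |z|≤
                            , z≢0 (suc N , cong suc (sym (ℕₚ.+-suc N N)))

bij-by-inverse : ∀ {m n} (g : ℕ → ℤ) (h : ℤ → ℕ) →
                 (∀ i → i < m → InLabels n (g i)) →
                 (∀ i → i < m → h (g i) ≡ i) →
                 (∀ z → InLabels n z → h z < m × g (h z) ≡ z) →
                 BijOntoLabels m n (λ x → g (toℕ x))
bij-by-inverse g h into left right = injective , (λ x → into (toℕ x) (toℕ<n x)) , surjective
  where
  injective : ∀ {x y} → g (toℕ x) ≡ g (toℕ y) → x ≡ y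
  injective {x} {y} gx≡gy = toℕ-injective (begin
    toℕ x           ≡⟨ left (toℕ x) (toℕ<n x) ⟨
    h (g (toℕ x))   ≡⟨ cong h gx≡gy ⟩
    h (g (toℕ y))   ≡⟨ left (toℕ y) (toℕ<n y) ⟩
    toℕ y           ∎)
    where open ≡-Reasoning
  surjective : ∀ z → InLabels _ z → ∃ λ x → g (toℕ x) ≡ z
  surjective z z∈ with right z z∈
  ... | hz<m , ghz≡z = fromℕ< hz<m , trans (cong g (toℕ-fromℕ< hz<m)) ghz≡z

next : ℤ → ℤ
next (+ zero)  = + 1
next (+ suc k) = -[1+ k ]
next -[1+ k ]  = + suc (suc k)

φ : ℕ → ℤ
φ zero    = + 0
φ (suc i) = next (φ i)

index : ℤ → ℕ
index (+ zero)  = 0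
index (+ suc t) = suc (t ℕ.+ t)
index -[1+ t ]  = suc (suc (t ℕ.+ t))

index-next : ∀ z → index (next z) ≡ suc (index z)
index-next (+ zero)  = refl
index-next (+ suc k) = refl
index-next -[1+ k ]  = cong (λ n → suc (suc n)) (ℕₚ.+-suc k k)

index-φ : ∀ i → index (φ i) ≡ i
index-φ zero    = refl
index-φ (suc i) = trans (index-next (φ i)) (cong suc (index-φ i))

φ-odd : ∀ t → φ (suc (t ℕ.+ t)) ≡ + suc t
φ-odd zero    = refl
φ-odd (suc t) rewrite ℕₚ.+-suc t t | φ-odd t = refl

φ-even : ∀ t → φ (suc (suc (t ℕ.+ t))) ≡ -[1+ t ]
φ-even t = cong next (φ-odd t)

φ-index : ∀ z → φ (index z) ≡ z
φ-index (+ zero)  = refl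
φ-index (+ suc t) = φ-odd t
φ-index -[1+ t ]  = φ-even t

φ-injective : ∀ {i k} → φ i ≡ φ k → i ≡ k
φ-injective {i} {k} φi≡φk = trans (sym (index-φ i)) (trans (cong index φi≡φk) (index-φ k))

index-≤ : ∀ z → index z ≤ ∣ z ∣ ℕ.+ ∣ z ∣
index-≤ (+ zero)  = z≤n
index-≤ (+ suc t) = s≤s (ℕₚ.+-monoʳ-≤ t (ℕₚ.n≤1+n t))
index-≤ -[1+ t ]  = ℕₚ.≤-reflexive (cong suc (sym (ℕₚ.+-suc t t)))

index-≥ : ∀ z → ∣ z ∣ ℕ.+ ∣ z ∣ ≤ suc (index z)
index-≥ (+ zero)  = z≤n
index-≥ (+ suc t) = ℕₚ.≤-reflexive (cong suc (ℕₚ.+-suc t t))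
index-≥ -[1+ t ]  = s≤s (ℕₚ.≤-trans (ℕₚ.≤-reflexive (ℕₚ.+-suc t t)) (ℕₚ.n≤1+n _))

φ-bounded : ∀ {N i} → i ≤ N ℕ.+ N → ∣ φ i ∣ ≤ N
φ-bounded {N} {i} i≤2N = double-≤ (ℕₚ.≤-trans (index-≥ (φ i)) (s≤s (subst (_≤ N ℕ.+ N) (sym (index-φ i)) i≤2N)))

index-bounded : ∀ {N z} → ∣ z ∣ ≤ N → index z ≤ N ℕ.+ N
index-bounded {z = z} |z|≤N = ℕₚ.≤-trans (index-≤ z) (ℕₚ.+-mono-≤ |z|≤N |z|≤N)

sumRange : (ℕ → ℤ) → ℕ → ℕ → ℤ
sumRange g lo zero    = 0ℤ
sumRange g lo (suc n) = g lo ℤ.+ sumRange g (suc lo) n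

-- Starting at an odd position, φ runs through pairs t, -t, which cancel.
φ-pairs-cancel : ∀ t k → sumRange φ (suc (t ℕ.+ t)) (k ℕ.+ k) ≡ 0ℤ
φ-pairs-cancel t zero    = refl
φ-pairs-cancel t (suc k) = begin
  sumRange φ (suc (t ℕ.+ t)) (suc (k ℕ.+ suc k))
    ≡⟨ cong (λ n → sumRange φ (suc (t ℕ.+ t)) (suc n)) (ℕₚ.+-suc k k) ⟩
  φ (suc (t ℕ.+ t)) ℤ.+ (φ (suc (suc (t ℕ.+ t))) ℤ.+ sumRange φ (suc (suc (suc (t ℕ.+ t)))) (k ℕ.+ k))
    ≡⟨ cong₂ (λ x y → x ℤ.+ (y ℤ.+ sumRange φ (suc (suc (suc (t ℕ.+ t)))) (k ℕ.+ k))) (φ-odd t) (φ-even t) ⟩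
  + suc t ℤ.+ (-[1+ t ] ℤ.+ sumRange φ (suc (suc (suc (t ℕ.+ t)))) (k ℕ.+ k))
    ≡⟨ cong (λ n → + suc t ℤ.+ (-[1+ t ] ℤ.+ sumRange φ (suc (suc n)) (k ℕ.+ k))) (sym (ℕₚ.+-suc t t)) ⟩
  + suc t ℤ.+ (-[1+ t ] ℤ.+ sumRange φ (suc (suc t ℕ.+ suc t)) (k ℕ.+ k))
    ≡⟨ cong (λ x → + suc t ℤ.+ (-[1+ t ] ℤ.+ x)) (φ-pairs-cancel (suc t) k) ⟩
  + suc t ℤ.+ (-[1+ t ] ℤ.+ 0ℤ)
    ≡⟨ trans (cong (λ x → + suc t ℤ.+ x) (ℤₚ.+-identityʳ -[1+ t ])) (ℤₚ.+-inverseʳ (+ suc t)) ⟩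
  0ℤ ∎
  where open ≡-Reasoning

swap : ℤ → ℤ → ℤ → ℤ
swap x y z with z ℤ.≟ x
... | yes _ = y
... | no _ with z ℤ.≟ y
...   | yes _ = x
...   | no _  = z

swap-left : ∀ x y → swap x y x ≡ y
swap-left x y with x ℤ.≟ x
... | yes _  = refl
... | no x≢x = ⊥-elim (x≢x refl)

swap-right : ∀ x y → swap x y y ≡ x
swap-right x y with y ℤ.≟ x
... | yes y≡x = y≡x
... | no _ with y ℤ.≟ y
...   | yes _  = refl
...   | no y≢y = ⊥-elim (y≢y refl)

swap-other : ∀ {x y z} → z ≢ x → z ≢ y → swap x y z ≡ z
swap-other {x} {y} {z} z≢x z≢y with z ℤ.≟ x
... | yes z≡x = ⊥-elim (z≢x z≡x)
... | no _ with z ℤ.≟ y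
...   | yes z≡y = ⊥-elim (z≢y z≡y)
...   | no _    = refl

swap-involutive : ∀ x y z → swap x y (swap x y z) ≡ z
swap-involutive x y z with z ℤ.≟ x
... | yes refl = swap-right z y
... | no z≢x with z ℤ.≟ y
...   | yes refl = swap-left x z
...   | no z≢y   = swap-other z≢x z≢y

swap-preserves : ∀ (P : ℤ → Set) {x y z} → P x → P y → P z → P (swap x y z)
swap-preserves P {x} {y} {z} px py pz with z ℤ.≟ x
... | yes _ = py
... | no _ with z ℤ.≟ y
...   | yes _ = px
...   | no _  = pz

swap01 : ℤ → ℤ
swap01 = swap (+ 0) (+ 1)

swapN : ℕ → ℤ → ℤ
swapN N = swap -[1+ 0 ] (+ N)

-- The edge labelling for a tree with 2N+1 edges, and its inverse.  Since the swaps are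
-- involutions these are mutually inverse on all of ℕ and ℤ.
edgeLabel : ℕ → ℕ → ℤ
edgeLabel N i = swap01 (swapN N (φ i))

edgeIndex : ℕ → ℤ → ℕ
edgeIndex N z = index (swapN N (swap01 z))

edgeIndex-label : ∀ N i → edgeIndex N (edgeLabel N i) ≡ i
edgeIndex-label N i = begin
  index (swapN N (swap01 (swap01 (swapN N (φ i)))))  ≡⟨ cong (λ w → index (swapN N w)) (swap-involutive (+ 0) (+ 1) (swapN N (φ i))) ⟩
  index (swapN N (swapN N (φ i)))                    ≡⟨ cong index (swap-involutive -[1+ 0 ] (+ N) (φ i)) ⟩
  index (φ i)                                        ≡⟨ index-φ i ⟩
  i                                                  ∎
  where open ≡-Reasoning

edgeLabel-index : ∀ N z → edgeLabel N (edgeIndex N z) ≡ z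
edgeLabel-index N z = begin
  swap01 (swapN N (φ (index (swapN N (swap01 z)))))  ≡⟨ cong (λ w → swap01 (swapN N w)) (φ-index (swapN N (swap01 z))) ⟩
  swap01 (swapN N (swapN N (swap01 z)))              ≡⟨ cong swap01 (swap-involutive -[1+ 0 ] (+ N) (swap01 z)) ⟩
  swap01 (swap01 z)                                  ≡⟨ swap-involutive (+ 0) (+ 1) z ⟩
  z                                                  ∎
  where open ≡-Reasoning

edgeLabel-injective : ∀ {N i k} → edgeLabel N i ≡ edgeLabel N k → i ≡ k
edgeLabel-injective {N} {i} {k} eq =
  trans (sym (edgeIndex-label N i)) (trans (cong (edgeIndex N) eq) (edgeIndex-label N k))

-- For N ≥ 1 the swaps keep {|z| ≤ N} invariant, so edgeLabel N is a bijection from the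
-- 2N+1 edges onto the odd-size label set.
module _ {N : ℕ} (1≤N : 1 ≤ N) where
  private
    Bounded : ℤ → Set
    Bounded z = ∣ z ∣ ≤ N

    swap01-bounded : ∀ z → Bounded z → Bounded (swap01 z)
    swap01-bounded z = swap-preserves Bounded {+ 0} {+ 1} {z} z≤n 1≤N

    swapN-bounded : ∀ z → Bounded z → Bounded (swapN N z)
    swapN-bounded z = swap-preserves Bounded { -[1+ 0 ]} {+ N} {z} 1≤N ℕₚ.≤-refl

  edgeLabel-bounded : ∀ {i} → i ≤ N ℕ.+ N → ∣ edgeLabel N i ∣ ≤ N
  edgeLabel-bounded {i} i≤2N = swap01-bounded (swapN N (φ i)) (swapN-bounded (φ i) (φ-bounded i≤2N))

  edgeIndex-bounded : ∀ z → ∣ z ∣ ≤ N → edgeIndex N z ≤ N ℕ.+ N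
  edgeIndex-bounded z |z|≤N = index-bounded (swapN-bounded (swap01 z) (swap01-bounded z |z|≤N))

  edgeLabel-bijective : BijOntoLabels (suc (N ℕ.+ N)) (suc (N ℕ.+ N)) (λ e → edgeLabel N (toℕ e))
  edgeLabel-bijective = bij-by-inverse (edgeLabel N) (edgeIndex N)
    (λ i i≤2N → odd-labels⁺ (edgeLabel-bounded (ℕₚ.≤-pred i≤2N)))
    (λ i _ → edgeIndex-label N i)
    (λ z z∈ → s≤s (edgeIndex-bounded z (odd-labels⁻ z∈)) , edgeLabel-index N z)

module _ {N : ℕ} where

  edgeLabel-0 : 2 ≤ N → edgeLabel N 0 ≡ + 1
  edgeLabel-0 (s≤s (s≤s _)) = refl

  edgeLabel-1 : 2 ≤ N → edgeLabel N 1 ≡ + 0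
  edgeLabel-1 (s≤s (s≤s _)) = refl

  edgeLabel-2 : 2 ≤ N → edgeLabel N 2 ≡ + N
  edgeLabel-2 (s≤s (s≤s _)) = refl

  edgeLabel-penultimate : edgeLabel N (index (+ N)) ≡ -[1+ 0 ]
  edgeLabel-penultimate rewrite φ-index (+ N) | swap-right -[1+ 0 ] (+ N) = refl

  edgeLabel-last : 2 ≤ N → edgeLabel N (index (ℤ.- (+ N))) ≡ ℤ.- (+ N)
  edgeLabel-last (s≤s (s≤s {n = M} _)) rewrite φ-index -[1+ suc M ] = refl

  edgeLabel-middle : ∀ {i} → 3 ≤ i → i < index (+ N) → edgeLabel N i ≡ φ i
  edgeLabel-middle {i} 3≤i i<top =
    trans (cong swap01 (swap-other (λ eq → below3 (φ-injective {k = 2} eq) ℕₚ.≤-refl) φi≢N))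
          (swap-other (λ eq → below3 (φ-injective {k = 0} eq) (s≤s z≤n))
                      (λ eq → below3 (φ-injective {k = 1} eq) (s≤s (s≤s z≤n))))
    where
    below3 : ∀ {k} → i ≡ k → k < 3 → ⊥
    below3 refl k<3 = ℕₚ.<⇒≱ k<3 3≤i
    φi≢N : φ i ≢ + N
    φi≢N eq = ℕₚ.<⇒≢ i<top (φ-injective (trans eq (sym (φ-index (+ N)))))

-- Since edgeLabel N 0 = 1,
-- vertex k+1 carries edgeLabel N k for every k ≠ 1.
vertexLabel : ℕ → ℕ → ℤ
vertexLabel N zero                = + suc N
vertexLabel N (suc zero)          = edgeLabel N 0
vertexLabel N (suc (suc zero))    = -[1+ N ]
vertexLabel N (suc (suc (suc k))) = edgeLabel N (suc (suc k))

vertexLabel-suc : ∀ N {k} → k ≢ 1 → vertexLabel N (suc k) ≡ edgeLabel N k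
vertexLabel-suc N {zero}          _   = refl
vertexLabel-suc N {suc zero}      k≢1 = ⊥-elim (k≢1 refl)
vertexLabel-suc N {suc (suc k)}   _   = refl

vertexIndex : ℕ → ℤ → ℕ
vertexIndex N (+ k) with k ℕ.≟ suc N
... | yes _ = 0
... | no _  = suc (edgeIndex N (+ k))
vertexIndex N -[1+ k ] with k ℕ.≟ N
... | yes _ = 2
... | no _  = suc (edgeIndex N -[1+ k ])

vertexIndex-top : ∀ N → vertexIndex N (+ suc N) ≡ 0
vertexIndex-top N with suc N ℕ.≟ suc N
... | yes _ = refl
... | no ≢  = ⊥-elim (≢ refl)

vertexIndex-bottom : ∀ N → vertexIndex N -[1+ N ] ≡ 2
vertexIndex-bottom N with N ℕ.≟ N
... | yes _ = refl
... | no ≢  = ⊥-elim (≢ refl)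

vertexIndex-small : ∀ N z → ∣ z ∣ ≤ N → vertexIndex N z ≡ suc (edgeIndex N z)
vertexIndex-small N (+ k) k≤N with k ℕ.≟ suc N
... | yes refl = ⊥-elim (ℕₚ.1+n≰n k≤N)
... | no _     = refl
vertexIndex-small N -[1+ k ] 1+k≤N with k ℕ.≟ N
... | yes refl = ⊥-elim (ℕₚ.1+n≰n 1+k≤N)
... | no _     = refl

top-bottom-or-small : ∀ {N} z → ∣ z ∣ ≤ suc N → z ≡ + suc N ⊎ z ≡ -[1+ N ] ⊎ ∣ z ∣ ≤ N
top-bottom-or-small (+ k) k≤1+N with ℕₚ.m≤n⇒m<n∨m≡n k≤1+N
... | inj₁ k<1+N = inj₂ (inj₂ (ℕₚ.≤-pred k<1+N))
... | inj₂ refl  = inj₁ refl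
top-bottom-or-small -[1+ k ] 1+k≤1+N with ℕₚ.m≤n⇒m<n∨m≡n 1+k≤1+N
... | inj₁ 1+k<1+N = inj₂ (inj₂ (ℕₚ.≤-pred 1+k<1+N))
... | inj₂ refl    = inj₂ (inj₁ refl)

-- For N ≥ 2, vertexLabel N is a bijection from the 2N+2 vertices onto the even-size
-- label set; the one edge label it skips is edgeLabel N 1 = 0.
module _ {N : ℕ} (2≤N : 2 ≤ N) where
  private
    1≤N : 1 ≤ N
    1≤N = ℕₚ.≤-trans (s≤s z≤n) 2≤N

    m : ℕ
    m = suc (suc (N ℕ.+ N))

    leaf-into : ∀ k → k ≢ 1 → k ≤ N ℕ.+ N → InLabels m (vertexLabel N (suc k))
    leaf-into k k≢1 k≤2N rewrite vertexLabel-suc N k≢1 =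
      even-labels⁺ (ℕₚ.m≤n⇒m≤1+n (edgeLabel-bounded 1≤N k≤2N))
                   (λ eq → k≢1 (edgeLabel-injective (trans eq (sym (edgeLabel-1 2≤N)))))

    into : ∀ w → w < m → InLabels m (vertexLabel N w)
    into zero                _   = even-labels⁺ ℕₚ.≤-refl (λ ())
    into (suc zero)          w<m = leaf-into 0 (λ ()) z≤n
    into (suc (suc zero))    _   = even-labels⁺ ℕₚ.≤-refl (λ ())
    into (suc (suc (suc k))) w<m = leaf-into (suc (suc k)) (λ ()) (ℕₚ.≤-pred (ℕₚ.≤-pred w<m))

    leaf-left : ∀ k → k ≢ 1 → k ≤ N ℕ.+ N → vertexIndex N (vertexLabel N (suc k)) ≡ suc k
    leaf-left k k≢1 k≤2N rewrite vertexLabel-suc N k≢1 =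
      trans (vertexIndex-small N (edgeLabel N k) (edgeLabel-bounded 1≤N k≤2N)) (cong suc (edgeIndex-label N k))

    left : ∀ w → w < m → vertexIndex N (vertexLabel N w) ≡ w
    left zero                _   = vertexIndex-top N
    left (suc zero)          _   = leaf-left 0 (λ ()) z≤n
    left (suc (suc zero))    _   = vertexIndex-bottom N
    left (suc (suc (suc k))) w<m = leaf-left (suc (suc k)) (λ ()) (ℕₚ.≤-pred (ℕₚ.≤-pred w<m))

    right : ∀ z → InLabels m z → vertexIndex N z < m × vertexLabel N (vertexIndex N z) ≡ z
    right z z∈ with even-labels⁻ z∈
    ... | |z|≤1+N , z≢0 with top-bottom-or-small {N} z |z|≤1+N
    ...   | inj₁ refl        rewrite vertexIndex-top N    = s≤s z≤n , refl
    ...   | inj₂ (inj₁ refl) rewrite vertexIndex-bottom N = s≤s (s≤s 1≤2N) , refl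
      where
      1≤2N : 1 ≤ N ℕ.+ N
      1≤2N = ℕₚ.≤-trans 1≤N (ℕₚ.m≤m+n N N)
    ...   | inj₂ (inj₂ |z|≤N) rewrite vertexIndex-small N z |z|≤N =
      s≤s (s≤s (edgeIndex-bounded 1≤N z |z|≤N)) , trans (vertexLabel-suc N index≢1) (edgeLabel-index N z)
      where
      index≢1 : edgeIndex N z ≢ 1
      index≢1 eq = z≢0 (trans (sym (edgeLabel-index N z)) (trans (cong (edgeLabel N) eq) (edgeLabel-1 2≤N)))

  vertexLabel-bijective : BijOntoLabels m m (λ v → vertexLabel N (toℕ v))
  vertexLabel-bijective = bij-by-inverse (vertexLabel N) (vertexIndex N) into left right

sumRange-split : ∀ g lo n k → sumRange g lo (n ℕ.+ k) ≡ sumRange g lo n ℤ.+ sumRange g (lo ℕ.+ n) k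
sumRange-split g lo zero    k rewrite ℕₚ.+-identityʳ lo = sym (ℤₚ.+-identityˡ _)
sumRange-split g lo (suc n) k rewrite sumRange-split g (suc lo) n k | ℕₚ.+-suc lo n =
  sym (ℤₚ.+-assoc (g lo) _ _)

sumRange-cong : ∀ {g h} lo n → (∀ i → lo ≤ i → i < lo ℕ.+ n → g i ≡ h i) → sumRange g lo n ≡ sumRange h lo n
sumRange-cong lo zero    _  = refl
sumRange-cong lo (suc n) eq = cong₂ ℤ._+_ (eq lo ℕₚ.≤-refl (ℕₚ.m<m+n lo (s≤s z≤n)))
  (sumRange-cong (suc lo) n λ i lo<i i<end →
    eq i (ℕₚ.<⇒≤ lo<i) (ℕₚ.≤-trans i<end (ℕₚ.≤-reflexive (sym (ℕₚ.+-suc lo n)))))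

sumRange-zero : ∀ {g} lo n → (∀ i → lo ≤ i → i < lo ℕ.+ n → g i ≡ 0ℤ) → sumRange g lo n ≡ 0ℤ
sumRange-zero lo n eq = trans (sumRange-cong lo n eq) (zeros lo n)
  where
  zeros : ∀ lo n → sumRange (λ _ → 0ℤ) lo n ≡ 0ℤ
  zeros lo zero    = refl
  zeros lo (suc n) = trans (ℤₚ.+-identityˡ _) (zeros (suc lo) n)

sumRange-single : ∀ {g} lo n c → lo ≤ c → c < lo ℕ.+ n → (∀ i → i ≢ c → g i ≡ 0ℤ) → sumRange g lo n ≡ g c
sumRange-single lo zero c lo≤c c<lo+0 _ =
  ⊥-elim (ℕₚ.<⇒≱ (subst (c <_) (ℕₚ.+-identityʳ lo) c<lo+0) lo≤c)
sumRange-single {g} lo (suc n) c lo≤c c<end off with lo ℕ.≟ c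
... | yes refl = trans (cong (λ x → g lo ℤ.+ x) (sumRange-zero (suc lo) n λ i lo<i _ → off i (ℕₚ.>⇒≢ lo<i)))
                       (ℤₚ.+-identityʳ (g lo))
... | no lo≢c  = trans (cong₂ ℤ._+_ (off lo lo≢c) rest) (ℤₚ.+-identityˡ (g c))
  where
  rest : sumRange g (suc lo) n ≡ g c
  rest = sumRange-single (suc lo) n c (ℕₚ.≤∧≢⇒< lo≤c lo≢c) (subst (c <_) (ℕₚ.+-suc lo n) c<end) off

sum-tabulate : ∀ {n} (g : Fin n → ℤ) (h : ℕ → ℤ) lo → (∀ e → g e ≡ h (lo ℕ.+ toℕ e)) →
               foldr ℤ._+_ 0ℤ (tabulate g) ≡ sumRange h lo n
sum-tabulate {zero}  g h lo eq = refl
sum-tabulate {suc n} g h lo eq =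
  cong₂ ℤ._+_ (trans (eq zero) (cong h (ℕₚ.+-identityʳ lo)))
              (sum-tabulate (λ e → g (suc e)) h (suc lo) λ e → trans (eq (suc e)) (cong h (ℕₚ.+-suc lo (toℕ e))))

isYes-toℕ : ∀ {n} (x y : Fin n) → ⌊ x Finₚ.≟ y ⌋ ≡ does (toℕ x ℕ.≟ toℕ y)
isYes-toℕ x y with x Finₚ.≟ y
... | yes refl = sym (dec-true (toℕ x ℕ.≟ toℕ x) refl)
... | no x≢y   = sym (dec-false (toℕ x ℕ.≟ toℕ y) (λ eq → x≢y (toℕ-injective eq)))

if-T : ∀ {A : Set} {b} {x y : A} → T b → (if b then x else y) ≡ x
if-T {b = true} _ = refl

if-¬T : ∀ {A : Set} {b} {x y : A} → ¬ T b → (if b then x else y) ≡ y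
if-¬T {b = false} _  = refl
if-¬T {b = true}  ¬t = ⊥-elim (¬t _)

module RT-incidence (j a b : ℕ) where

  Q : ℕ
  Q = 2 ℕ.+ j ℕ.+ a ℕ.+ b

  parent : ℕ → ℕ
  parent k = toℕ (RT-parent j a b k)

  parent-root : ∀ {k} → k ≤ 2 ℕ.+ j → parent k ≡ 0
  parent-root k≤ = cong toℕ (if-T (ℕₚ.≤⇒≤ᵇ k≤))

  parent-left : ∀ {k} → 2 ℕ.+ j < k → k ≤ 2 ℕ.+ j ℕ.+ a → parent k ≡ 1
  parent-left {k} c0<k k≤c1 =
    cong toℕ (trans (if-¬T (λ t → ℕₚ.<⇒≱ c0<k (ℕₚ.≤ᵇ⇒≤ k _ t))) (if-T (ℕₚ.≤⇒≤ᵇ k≤c1)))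

  parent-right : ∀ {k} → 2 ℕ.+ j ℕ.+ a < k → parent k ≡ 2
  parent-right {k} c1<k =
    cong toℕ (trans (if-¬T (λ t → ℕₚ.<⇒≱ c0<k (ℕₚ.≤ᵇ⇒≤ k _ t))) (if-¬T (λ t → ℕₚ.<⇒≱ c1<k (ℕₚ.≤ᵇ⇒≤ k _ t))))
    where
    c0<k : 2 ℕ.+ j < k
    c0<k = ℕₚ.≤-trans (s≤s (ℕₚ.m≤m+n (2 ℕ.+ j) a)) c1<k

  parent-≤2 : ∀ k → parent k ≤ 2
  parent-≤2 k with k ≤ᵇ (2 ℕ.+ j) | k ≤ᵇ (2 ℕ.+ j ℕ.+ a)
  ... | true  | _     = z≤n
  ... | false | true  = s≤s z≤n
  ... | false | false = ℕₚ.≤-refl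

  edgeTerm : (ℕ → ℤ) → ℕ → ℕ → ℤ
  edgeTerm f w i = if does (parent (suc i) ℕ.≟ w) ∨ does (suc i ℕ.≟ w) then f i else 0ℤ

  vertexSum-as-sumRange : ∀ f v → vertexSum (RT j a b) (λ e → f (toℕ e)) v ≡ sumRange (edgeTerm f (toℕ v)) 0 Q
  vertexSum-as-sumRange f v =
    trans (cong (foldr ℤ._+_ 0ℤ) (map-tabulate (λ e → e) term))
          (sum-tabulate term (edgeTerm f (toℕ v)) 0 λ e →
            cong (λ c → if c then f (toℕ e) else 0ℤ)
                 (cong₂ _∨_ (isYes-toℕ (RT-parent j a b (suc (toℕ e))) v) (isYes-toℕ (suc e) v)))
    where
    term : Fin Q → ℤ
    term e = if incident (RT j a b) e v then f (toℕ e) else 0ℤ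

  edgeTerm-on : ∀ f w i → parent (suc i) ≡ w ⊎ suc i ≡ w → edgeTerm f w i ≡ f i
  edgeTerm-on f w i (inj₁ p≡w) =
    cong (λ c → if c ∨ does (suc i ℕ.≟ w) then f i else 0ℤ) (dec-true (parent (suc i) ℕ.≟ w) p≡w)
  edgeTerm-on f w i (inj₂ i+1≡w) =
    trans (cong (λ c → if does (parent (suc i) ℕ.≟ w) ∨ c then f i else 0ℤ) (dec-true (suc i ℕ.≟ w) i+1≡w))
          (cong (λ c → if c then f i else 0ℤ) (∨-zeroʳ _))

  edgeTerm-off : ∀ f w i → parent (suc i) ≢ w → suc i ≢ w → edgeTerm f w i ≡ 0ℤ
  edgeTerm-off f w i p≢w i+1≢w
    rewrite dec-false (parent (suc i) ℕ.≟ w) p≢w | dec-false (suc i ℕ.≟ w) i+1≢w = refl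

  sumRange-blocks : ∀ g → sumRange g 0 Q ≡ (sumRange g 0 (2 ℕ.+ j) ℤ.+ sumRange g (2 ℕ.+ j) a) ℤ.+ sumRange g (2 ℕ.+ j ℕ.+ a) b
  sumRange-blocks g = trans (sumRange-split g 0 (2 ℕ.+ j ℕ.+ a) b)
                            (cong (ℤ._+ sumRange g (2 ℕ.+ j ℕ.+ a) b) (sumRange-split g 0 (2 ℕ.+ j) a))

  private
    from-blocks : ∀ g {x y z} → sumRange g 0 (2 ℕ.+ j) ≡ x → sumRange g (2 ℕ.+ j) a ≡ y →
                  sumRange g (2 ℕ.+ j ℕ.+ a) b ≡ z → sumRange g 0 Q ≡ (x ℤ.+ y) ℤ.+ z
    from-blocks g root left right = trans (sumRange-blocks g) (cong₂ ℤ._+_ (cong₂ ℤ._+_ root left) right)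

    left-edge : ∀ {i} → 2 ℕ.+ j ≤ i → i < 2 ℕ.+ j ℕ.+ a → parent (suc i) ≡ 1
    left-edge c0≤i i<c1 = parent-left (s≤s c0≤i) i<c1

    right-edge : ∀ {i} → 2 ℕ.+ j ℕ.+ a ≤ i → parent (suc i) ≡ 2
    right-edge c1≤i = parent-right (s≤s c1≤i)

    ≢-by : ∀ {m n k : ℕ} → m ≡ n → n ≢ k → m ≢ k
    ≢-by refl n≢k = n≢k

    suc-≢ : ∀ {i w} → w ≤ i → suc i ≢ w
    suc-≢ w≤i refl = ℕₚ.1+n≰n w≤i

  root-sum : ∀ f → sumRange (edgeTerm f 0) 0 Q ≡ sumRange f 0 (2 ℕ.+ j)
  root-sum f = trans
    (from-blocks (edgeTerm f 0) (sumRange-cong {h = f} 0 (2 ℕ.+ j) λ i _ i<c0 → edgeTerm-on f 0 i (inj₁ (parent-root i<c0)))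
                 (sumRange-zero (2 ℕ.+ j) a λ i c0≤i i<c1 → edgeTerm-off f 0 i (≢-by (left-edge c0≤i i<c1) (λ ())) (λ ()))
                 (sumRange-zero (2 ℕ.+ j ℕ.+ a) b λ i c1≤i _ → edgeTerm-off f 0 i (≢-by (right-edge c1≤i) (λ ())) (λ ())))
    (trans (ℤₚ.+-identityʳ _) (ℤₚ.+-identityʳ _))

  vertex1-sum : ∀ f → sumRange (edgeTerm f 1) 0 Q ≡ f 0 ℤ.+ sumRange f (2 ℕ.+ j) a
  vertex1-sum f = trans
    (from-blocks (edgeTerm f 1)
      (cong₂ ℤ._+_ (edgeTerm-on f 1 0 (inj₂ refl))
                   (sumRange-zero 1 (suc j) λ i 1≤i i<c0 → edgeTerm-off f 1 i (≢-by (parent-root i<c0) (λ ())) (suc-≢ 1≤i)))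
      (sumRange-cong {h = f} (2 ℕ.+ j) a λ i c0≤i i<c1 → edgeTerm-on f 1 i (inj₁ (left-edge c0≤i i<c1)))
      (sumRange-zero (2 ℕ.+ j ℕ.+ a) b λ i c1≤i _ →
        edgeTerm-off f 1 i (≢-by (right-edge c1≤i) (λ ())) (suc-≢ (ℕₚ.≤-trans (s≤s z≤n) c1≤i))))
    (simplify (f 0) (sumRange f (2 ℕ.+ j) a))
    where
    simplify : ∀ x y → ((x ℤ.+ 0ℤ) ℤ.+ y) ℤ.+ 0ℤ ≡ x ℤ.+ y
    simplify = solve-∀

  vertex2-sum : ∀ f → sumRange (edgeTerm f 2) 0 Q ≡ f 1 ℤ.+ sumRange f (2 ℕ.+ j ℕ.+ a) b
  vertex2-sum f = trans
    (from-blocks (edgeTerm f 2)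
      (cong₂ ℤ._+_ (edgeTerm-off f 2 0 (≢-by (parent-root (s≤s z≤n)) (λ ())) (λ ()))
        (cong₂ ℤ._+_ (edgeTerm-on f 2 1 (inj₂ refl))
                     (sumRange-zero 2 j λ i 2≤i i<c0 → edgeTerm-off f 2 i (≢-by (parent-root i<c0) (λ ())) (suc-≢ 2≤i))))
      (sumRange-zero (2 ℕ.+ j) a λ i c0≤i i<c1 →
        edgeTerm-off f 2 i (≢-by (left-edge c0≤i i<c1) (λ ())) (suc-≢ (ℕₚ.≤-trans (s≤s (s≤s z≤n)) c0≤i)))
      (sumRange-cong {h = f} (2 ℕ.+ j ℕ.+ a) b λ i c1≤i _ → edgeTerm-on f 2 i (inj₁ (right-edge c1≤i))))
    (simplify (f 1) (sumRange f (2 ℕ.+ j ℕ.+ a) b))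
    where
    simplify : ∀ x y → ((0ℤ ℤ.+ (x ℤ.+ 0ℤ)) ℤ.+ 0ℤ) ℤ.+ y ≡ x ℤ.+ y
    simplify = solve-∀

  leaf-sum : ∀ f i → 2 ≤ i → i < Q → sumRange (edgeTerm f (suc i)) 0 Q ≡ f i
  leaf-sum f i 2≤i i<Q = trans (sumRange-single 0 Q i z≤n i<Q off) (edgeTerm-on f (suc i) i (inj₂ refl))
    where
    off : ∀ k → k ≢ i → edgeTerm f (suc i) k ≡ 0ℤ
    off k k≢i = edgeTerm-off f (suc i) k
      (λ eq → ℕₚ.1+n≰n (ℕₚ.≤-trans (s≤s 2≤i) (subst (_≤ 2) eq (parent-≤2 (suc k)))))
      (λ eq → k≢i (ℕₚ.suc-injective eq))

BijOntoLabels-ext : ∀ {m n} {g h : Fin m → ℤ} → (∀ x → g x ≡ h x) → BijOntoLabels m n h → BijOntoLabels m n g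
BijOntoLabels-ext g≗h (injective , into , onto) =
    (λ {x} {y} gx≡gy → injective (trans (sym (g≗h x)) (trans gx≡gy (g≗h y))))
  , (λ x → subst (InLabels _) (sym (g≗h x)) (into x))
  , (λ z z∈ → let (x , hx≡z) = onto z z∈ in x , trans (g≗h x) hx≡z)

module RT-labelling (s m n : ℕ) where

  open RT-incidence (suc (s ℕ.+ s)) (m ℕ.+ m) (suc n ℕ.+ suc n)

  M N : ℕ
  M = s ℕ.+ m ℕ.+ n
  N = suc (suc M)

  2≤N : 2 ≤ N
  2≤N = s≤s (s≤s z≤n)

  ε : ℕ → ℤ
  ε = edgeLabel N

  Q≡2N+1 : Q ≡ suc (N ℕ.+ N)
  Q≡2N+1 = lemma s m n
    where
    lemma : ∀ s m n → 2 ℕ.+ suc (s ℕ.+ s) ℕ.+ (m ℕ.+ m) ℕ.+ (suc n ℕ.+ suc n)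
                    ≡ suc (suc (suc (s ℕ.+ m ℕ.+ n)) ℕ.+ suc (suc (s ℕ.+ m ℕ.+ n)))
    lemma = ℕ-Solver.solve-∀

  -- Edges c0 … c1-1 hang from vertex 1 and edges c1 … 2N from vertex 2; the label +N sits
  -- at position L = 2N-1 of the enumeration, so edges 2N-1 and 2N close the last block.
  c0 c1 L : ℕ
  c0 = 2 ℕ.+ suc (s ℕ.+ s)
  c1 = c0 ℕ.+ (m ℕ.+ m)
  L  = index (+ N)

  c0-odd : c0 ≡ suc (suc s ℕ.+ suc s)
  c0-odd = lemma s
    where
    lemma : ∀ s → 2 ℕ.+ suc (s ℕ.+ s) ≡ suc (suc s ℕ.+ suc s)
    lemma = ℕ-Solver.solve-∀

  c1-odd : c1 ≡ suc (suc (s ℕ.+ m) ℕ.+ suc (s ℕ.+ m))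
  c1-odd = lemma s m
    where
    lemma : ∀ s m → 2 ℕ.+ suc (s ℕ.+ s) ℕ.+ (m ℕ.+ m) ≡ suc (suc (s ℕ.+ m) ℕ.+ suc (s ℕ.+ m))
    lemma = ℕ-Solver.solve-∀

  c1+2n≡L : c1 ℕ.+ (n ℕ.+ n) ≡ L
  c1+2n≡L = lemma s m n
    where
    lemma : ∀ s m n → 2 ℕ.+ suc (s ℕ.+ s) ℕ.+ (m ℕ.+ m) ℕ.+ (n ℕ.+ n)
                    ≡ suc (suc (s ℕ.+ m ℕ.+ n) ℕ.+ suc (s ℕ.+ m ℕ.+ n))
    lemma = ℕ-Solver.solve-∀

  c1≤L : c1 ≤ L
  c1≤L = ℕₚ.≤-trans (ℕₚ.m≤m+n c1 (n ℕ.+ n)) (ℕₚ.≤-reflexive c1+2n≡L)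

  -- Between the special edges the labelling is the plain enumeration, so consecutive pairs cancel.
  pairs-sum : ∀ lo t k → lo ≡ suc (t ℕ.+ t) → 1 ≤ t → lo ℕ.+ (k ℕ.+ k) ≤ L → sumRange ε lo (k ℕ.+ k) ≡ 0ℤ
  pairs-sum lo t k refl 1≤t end≤L = trans
    (sumRange-cong lo (k ℕ.+ k) λ i lo≤i i<end →
      edgeLabel-middle (ℕₚ.≤-trans (s≤s (ℕₚ.+-mono-≤ 1≤t 1≤t)) lo≤i) (ℕₚ.≤-trans i<end end≤L))
    (φ-pairs-cancel t k)

  root-value : sumRange (edgeTerm ε 0) 0 Q ≡ + suc N
  root-value = begin
    sumRange (edgeTerm ε 0) 0 Q
      ≡⟨ root-sum ε ⟩
    ε 0 ℤ.+ (ε 1 ℤ.+ (ε 2 ℤ.+ sumRange ε 3 (s ℕ.+ s)))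
      ≡⟨ cong₂ ℤ._+_ (edgeLabel-0 2≤N) (cong₂ ℤ._+_ (edgeLabel-1 2≤N) (cong₂ ℤ._+_ (edgeLabel-2 2≤N)
           (pairs-sum 3 1 s refl ℕₚ.≤-refl (ℕₚ.≤-trans (ℕₚ.m≤m+n c0 (m ℕ.+ m)) c1≤L)))) ⟩
    + 1 ℤ.+ (+ 0 ℤ.+ (+ N ℤ.+ 0ℤ))
      ≡⟨ cong (λ k → + suc k) (ℕₚ.+-identityʳ N) ⟩
    + suc N ∎
    where open ≡-Reasoning

  vertex1-value : sumRange (edgeTerm ε 1) 0 Q ≡ + 1
  vertex1-value = begin
    sumRange (edgeTerm ε 1) 0 Q
      ≡⟨ vertex1-sum ε ⟩
    ε 0 ℤ.+ sumRange ε c0 (m ℕ.+ m)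
      ≡⟨ cong₂ ℤ._+_ (edgeLabel-0 2≤N) (pairs-sum c0 (suc s) m c0-odd (s≤s z≤n) c1≤L) ⟩
    + 1 ℤ.+ 0ℤ
      ≡⟨⟩
    + 1 ∎
    where open ≡-Reasoning

  vertex2-value : sumRange (edgeTerm ε 2) 0 Q ≡ -[1+ N ]
  vertex2-value = begin
    sumRange (edgeTerm ε 2) 0 Q
      ≡⟨ vertex2-sum ε ⟩
    ε 1 ℤ.+ sumRange ε c1 (suc n ℕ.+ suc n)
      ≡⟨ cong (λ k → ε 1 ℤ.+ sumRange ε c1 k) (last-two n) ⟩
    ε 1 ℤ.+ sumRange ε c1 ((n ℕ.+ n) ℕ.+ 2)
      ≡⟨ cong (λ x → ε 1 ℤ.+ x) (sumRange-split ε c1 (n ℕ.+ n) 2) ⟩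
    ε 1 ℤ.+ (sumRange ε c1 (n ℕ.+ n) ℤ.+ sumRange ε (c1 ℕ.+ (n ℕ.+ n)) 2)
      ≡⟨ cong₂ (λ x y → x ℤ.+ (y ℤ.+ sumRange ε (c1 ℕ.+ (n ℕ.+ n)) 2)) (edgeLabel-1 2≤N)
           (pairs-sum c1 (suc (s ℕ.+ m)) n c1-odd (s≤s z≤n) (ℕₚ.≤-reflexive c1+2n≡L)) ⟩
    + 0 ℤ.+ (0ℤ ℤ.+ sumRange ε (c1 ℕ.+ (n ℕ.+ n)) 2)
      ≡⟨ cong (λ k → + 0 ℤ.+ (0ℤ ℤ.+ sumRange ε k 2)) c1+2n≡L ⟩
    + 0 ℤ.+ (0ℤ ℤ.+ (ε L ℤ.+ (ε (suc L) ℤ.+ 0ℤ)))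
      ≡⟨ cong₂ (λ x y → + 0 ℤ.+ (0ℤ ℤ.+ (x ℤ.+ (y ℤ.+ 0ℤ)))) (edgeLabel-penultimate {N}) (edgeLabel-last 2≤N) ⟩
    + 0 ℤ.+ (0ℤ ℤ.+ (-[1+ 0 ] ℤ.+ (-[1+ suc M ] ℤ.+ 0ℤ)))
      ≡⟨⟩
    -[1+ N ] ∎
    where
    open ≡-Reasoning
    last-two : ∀ n → suc n ℕ.+ suc n ≡ (n ℕ.+ n) ℕ.+ 2
    last-two = ℕ-Solver.solve-∀

  vertexSum-values : ∀ v → vertexSum (RT (suc (s ℕ.+ s)) (m ℕ.+ m) (suc n ℕ.+ suc n)) (λ e → ε (toℕ e)) v
                           ≡ vertexLabel N (toℕ v)
  vertexSum-values v = trans (vertexSum-as-sumRange ε v) (by-vertex (toℕ v) (toℕ<n v))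
    where
    by-vertex : ∀ w → w < suc Q → sumRange (edgeTerm ε w) 0 Q ≡ vertexLabel N w
    by-vertex zero                _     = root-value
    by-vertex (suc zero)          _     = vertex1-value
    by-vertex (suc (suc zero))    _     = vertex2-value
    by-vertex (suc (suc (suc k))) w<Q+1 = leaf-sum ε (suc (suc k)) (s≤s (s≤s z≤n)) (ℕₚ.≤-pred w<Q+1)

  superEdgeGraceful : SuperEdgeGraceful (RT (suc (s ℕ.+ s)) (m ℕ.+ m) (suc n ℕ.+ suc n))
  superEdgeGraceful =
      (λ e → ε (toℕ e))
    , subst (λ k → BijOntoLabels k k (λ e → ε (toℕ e))) (sym Q≡2N+1) (edgeLabel-bijective (s≤s z≤n))
    , BijOntoLabels-ext vertexSum-values
        (subst (λ k → BijOntoLabels k k (λ v → vertexLabel N (toℕ v))) (sym (cong suc Q≡2N+1))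
               (vertexLabel-bijective 2≤N))

-- Main theorem.  With j = 2s+1, a = 2m, b = 2k, the hypothesis 2 ≤ a ≤ b excludes k = 0,
-- and for k = n+1 the labelling above applies.
lemma4 : (j a b : ℕ) → Odd j → 1 ≤ j → Even a → Even b → 2 ≤ a → a ≤ b →
         SuperEdgeGraceful (RT j a b)
lemma4 _ _ _ (s , refl) _ (m , refl) (zero  , refl) 2≤a a≤0 with ℕₚ.≤-trans 2≤a a≤0
... | ()
lemma4 _ _ _ (s , refl) _ (m , refl) (suc n , refl) _ _ = RT-labelling.superEdgeGraceful s m n
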